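{- If $D$ is a $2$-acyclic multidigraph, then its directed tree complex $\mathrm{DT}(D)$ is vertex decomposable.
   Context: A multidigraph $D$ consists of finite sets $V(D)$, $E(D)$ and maps $s,t:E(D)\to V(D)$ (source, target). For $\sigma\subseteq E(D)$, $D[\sigma]$ is the multidigraph with edge set $\sigma$ and vertex set the endpoints of edges of $\sigma$. A directed cycle is a connected multidigraph without parallel edges in which every vertex has in-degree and out-degree $1$; its length is its number of vertices. $D$ is $2$-acyclic if it contains no directed cycle of length at least $3$. A directed forest is a digraph (no parallel edges) with no directed cycles in which no two distinct edges share the same target. The directed tree complex $\mathrm{DT}(D)$ is the simplicial complex on $E(D)$ whose faces are the $\sigma\subseteq E(D)$ with $D[\sigma]$ a directed forest. A simplicial complex $\Delta$ is vertex decomposable if it is a simplex (including the void complex and $\{\emptyset\}$), or there is a vertex $v$ with $\mathrm{lk}_\Delta(v)$ and $\mathrm{del}_\Delta(v)$ vertex decomposable and every facet of $\mathrm{del}_\Delta(v)$ a facet of $\Delta$. -}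

module Defs where

open import Data.Nat using (ℕ; suc; _<_; _≤_)
open import Data.Fin using (Fin)
open import Data.Fin.Subset using (Subset; _∈_; _∉_; _⊆_; _∪_; ⁅_⁆)
open import Data.Product using (Σ; _×_; ∃-syntax)
open import Data.Sum using (_⊎_)
open import Relation.Binary.PropositionalEquality using (_≡_)
open import Relation.Nullary using (¬_)
open import Level using (0ℓ; suc)

record Multidigraph : Set where
  field
    nV : ℕ
    nE : ℕ
    s  : Fin nE → Fin nV
    t  : Fin nE → Fin nV

open Multidigraph public

-- A directed cycle of length k (k ≥ 1) in the sub-multidigraph of D
-- spanned by the edges satisfying P: pairwise distinct vertices
-- c 0, …, c (k-1) and edges e i (satisfying P) from c i to c (i+1),
-- indices taken mod k (encoded by c k ≡ c 0).
record CycleIn (D : Multidigraph) (P : Fin (nE D) → Set) (k : ℕ) : Set where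
  field
    c        : ℕ → Fin (nV D)
    e        : ℕ → Fin (nE D)
    closed   : c k ≡ c 0
    inP      : ∀ i → i < k → P (e i)
    src      : ∀ i → i < k → s D (e i) ≡ c i
    tgt      : ∀ i → i < k → t D (e i) ≡ c (Data.Nat.suc i)
    distinct : ∀ i j → i < k → j < k → c i ≡ c j → i ≡ j

TwoAcyclic : Multidigraph → Set
TwoAcyclic D = ∀ k → 3 ≤ k → ¬ CycleIn D (λ _ → Data.Unit.⊤) k
  where import Data.Unit

-- D[σ] is a directed forest: no two distinct edges of σ share a target
-- (hence also no parallel edges), and D[σ] contains no directed cycle
-- (of any length ≥ 1, including loops).
IsDirectedForest : (D : Multidigraph) → Subset (nE D) → Set
IsDirectedForest D σ =
  (∀ e f → e ∈ σ → f ∈ σ → t D e ≡ t D f → e ≡ f)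
  × (∀ k → 1 ≤ k → ¬ CycleIn D (λ e → e ∈ σ) k)

-- Simplicial complexes on the ground set Fin m, given by their set of
-- faces (a predicate on subsets; assumed down-closed where relevant).

Complex : ℕ → Set₁
Complex m = Subset m → Set

DT : (D : Multidigraph) → Complex (nE D)
DT D σ = IsDirectedForest D σ

module _ {m : ℕ} where

  _⇔_ : Set → Set → Set
  A ⇔ B = (A → B) × (B → A)

  IsSimplex : Complex m → Set
  IsSimplex Δ = (∀ τ → ¬ Δ τ) ⊎ (Σ (Subset m) λ σ → ∀ τ → Δ τ ⇔ (τ ⊆ σ))

  IsFacet : Complex m → Subset m → Set
  IsFacet Δ σ = Δ σ × (∀ τ → Δ τ → σ ⊆ τ → τ ⊆ σ)

  lk : Complex m → Fin m → Complex m
  lk Δ v τ = (v ∉ τ) × Δ (τ ∪ ⁅ v ⁆)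

  del : Complex m → Fin m → Complex m
  del Δ v τ = (v ∉ τ) × Δ τ

  data VertexDecomposable (Δ : Complex m) : Set₁ where
    simplex : IsSimplex Δ → VertexDecomposable Δ
    shed    : (v : Fin m) → Δ ⁅ v ⁆
            → VertexDecomposable (lk Δ v)
            → VertexDecomposable (del Δ v)
            → (∀ σ → IsFacet (del Δ v) σ → IsFacet Δ σ)
            → VertexDecomposable Δ

module Submission where

-- For 2-acyclic D, a set of edges spans a directed forest iff it contains no loop, no two edges
-- with a common target and no antiparallel pair, so DT(D) is the independence complex of this
-- "conflict" graph on the non-loop edges. An independence complex is vertex decomposable once
-- every induced subgraph with an edge has vertices e ≠ f with N[e] ⊆ N[f]: then f is a shedding
-- vertex, and link and deletion are independence complexes of smaller induced subgraphs. In the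
-- conflict graph such a pair exists: either two edges share a target and one of them has no
-- reverse arc, or every such edge is reversible, and then the digons of D form a forest (D has
-- no directed cycle of length ≥ 3); at a leaf w with neighbour u, the arc u → w is dominated by
-- the arc w → u.

open import Data.Empty using (⊥-elim)
open import Data.Fin.Base using (Fin)
open import Data.Fin.Properties using (_≟_; any?; injective⇒≤; toℕ-injective; toℕ<n)
open import Data.Fin.Subset using (Subset; _∈_; _⊆_; _⊂_; _∪_; ⁅_⁆)
open import Data.Fin.Subset.Induction using (Acc; acc; ⊂-wellFounded)
open import Data.Fin.Subset.Properties
  using (_∈?_; x∈⁅x⁆; x∈⁅y⁆⇒x≡y; x∈p∪q⁻; x∈p∪q⁺; p⊆p∪q; ⊆-refl; ⊆-trans; ⊆-⊂-trans)
open import Data.Nat.Base using (ℕ; zero; suc; _+_; _≤_; _<_; s≤s; z<s; s<s; sz<ss)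
open import Data.Nat.Properties using (≤-trans; <-trans; <⇒≢; ≤⇒≯; +-suc; m≤m+n; anyUpTo?)
open import Data.Product using (∃; ∃₂; _×_; _,_; proj₁; proj₂)
open import Data.Sum using (_⊎_; inj₁; inj₂; [_,_])
open import Data.Unit using (⊤; tt)
open import Data.Vec using (tabulate)
open import Data.Vec.Properties using (lookup∘tabulate; lookup⇒[]=; []=⇒lookup)
open import Function using (_∘_)
open import Relation.Binary.PropositionalEquality using (_≡_; _≢_; refl; sym; trans; cong; subst)
open import Relation.Nullary
  using (¬_; Dec; yes; no; does; proof; ¬?; _×-dec_; _⊎-dec_; contradiction)
open import Relation.Nullary.Decidable using (dec-true; decidable-stable)
open import Relation.Nullary.Reflects using (Reflects; invert)
open import Relation.Unary using (Decidable; _≐_)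
open import Relation.Unary.Properties using (≐-sym)

open import Defs

module _ {m : ℕ} {Δ Δ′ : Complex m} where

  isFacet-resp-≐ : Δ ≐ Δ′ → ∀ {σ} → IsFacet Δ σ → IsFacet Δ′ σ
  isFacet-resp-≐ (Δ⊆Δ′ , Δ′⊆Δ) (face , maximal) = Δ⊆Δ′ face , λ τ → maximal τ ∘ Δ′⊆Δ

  lk-resp-≐ : Δ ≐ Δ′ → ∀ v → lk Δ v ≐ lk Δ′ v
  lk-resp-≐ (Δ⊆Δ′ , Δ′⊆Δ) v = (λ (v∉ , face) → v∉ , Δ⊆Δ′ face) , (λ (v∉ , face) → v∉ , Δ′⊆Δ face)

  del-resp-≐ : Δ ≐ Δ′ → ∀ v → del Δ v ≐ del Δ′ v
  del-resp-≐ (Δ⊆Δ′ , Δ′⊆Δ) v = (λ (v∉ , face) → v∉ , Δ⊆Δ′ face) , (λ (v∉ , face) → v∉ , Δ′⊆Δ face)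

vertexDecomposable-resp-≐ : ∀ {m} {Δ Δ′ : Complex m} →
                            Δ ≐ Δ′ → VertexDecomposable Δ → VertexDecomposable Δ′
vertexDecomposable-resp-≐ (_ , Δ′⊆Δ) (simplex (inj₁ void)) = simplex (inj₁ λ τ → void τ ∘ Δ′⊆Δ)
vertexDecomposable-resp-≐ (Δ⊆Δ′ , Δ′⊆Δ) (simplex (inj₂ (σ , faces))) =
  simplex (inj₂ (σ , λ τ → proj₁ (faces τ) ∘ Δ′⊆Δ , Δ⊆Δ′ ∘ proj₂ (faces τ)))
vertexDecomposable-resp-≐ Δ≐Δ′ (shed v face lkVD delVD facets) =
  shed v (proj₁ Δ≐Δ′ face)
    (vertexDecomposable-resp-≐ (lk-resp-≐ Δ≐Δ′ v) lkVD)
    (vertexDecomposable-resp-≐ (del-resp-≐ Δ≐Δ′ v) delVD)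
    (λ σ → isFacet-resp-≐ Δ≐Δ′ ∘ facets σ ∘ isFacet-resp-≐ (del-resp-≐ (≐-sym Δ≐Δ′) v))

module _ {m : ℕ} {P : Fin m → Set} where

  subset : Decidable P → Subset m
  subset P? = tabulate (does ∘ P?)

  ∈-subset⁺ : (P? : Decidable P) → ∀ {x} → P x → x ∈ subset P?
  ∈-subset⁺ P? {x} px = lookup⇒[]= x _ (trans (lookup∘tabulate _ x) (dec-true (P? x) px))

  ∈-subset⁻ : (P? : Decidable P) → ∀ {x} → x ∈ subset P? → P x
  ∈-subset⁻ P? {x} x∈ =
    invert (subst (Reflects (P x)) (trans (sym (lookup∘tabulate _ x)) ([]=⇒lookup x∈))
                  (proof (P? x)))

module IndependenceComplex {m : ℕ} {_~_ : Fin m → Fin m → Set} (_~?_ : ∀ e f → Dec (e ~ f))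
  (~-sym : ∀ {e f} → e ~ f → f ~ e) (~-irrefl : ∀ {e} → ¬ e ~ e) where

  Independent : Subset m → Set
  Independent τ = ∀ {e f} → e ∈ τ → f ∈ τ → ¬ e ~ f

  Ind : Subset m → Complex m
  Ind A τ = τ ⊆ A × Independent τ

  HasEdge : Subset m → Set
  HasEdge A = ∃₂ λ e f → e ∈ A × f ∈ A × e ~ f

  hasEdge? : ∀ A → Dec (HasEdge A)
  hasEdge? A = any? λ e → any? λ f → e ∈? A ×-dec f ∈? A ×-dec e ~? f

  Dominates : Subset m → Fin m → Fin m → Set
  Dominates A f e = ∀ {g} → g ∈ A → g ≡ e ⊎ e ~ g → g ≡ f ⊎ f ~ g

  DominatedPair : Subset m → Set
  DominatedPair A = ∃₂ λ e f → e ∈ A × f ∈ A × e ≢ f × Dominates A f e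

  _∖_ : Subset m → Fin m → Subset m
  A ∖ v = subset λ x → x ∈? A ×-dec ¬? (x ≟ v)

  _∖N[_] : Subset m → Fin m → Subset m
  A ∖N[ v ] = subset λ x → x ∈? A ∖ v ×-dec ¬? (v ~? x)

  ∈-∖⁺ : ∀ {A v x} → x ∈ A → x ≢ v → x ∈ A ∖ v
  ∈-∖⁺ {A} {v} x∈A x≢v = ∈-subset⁺ (λ x → x ∈? A ×-dec ¬? (x ≟ v)) (x∈A , x≢v)

  ∈-∖⁻ : ∀ {A v x} → x ∈ A ∖ v → x ∈ A × x ≢ v
  ∈-∖⁻ {A} {v} = ∈-subset⁻ (λ x → x ∈? A ×-dec ¬? (x ≟ v))

  ∈-∖N⁺ : ∀ {A v x} → x ∈ A ∖ v → ¬ v ~ x → x ∈ A ∖N[ v ]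
  ∈-∖N⁺ {A} {v} x∈ v≁x = ∈-subset⁺ (λ x → x ∈? A ∖ v ×-dec ¬? (v ~? x)) (x∈ , v≁x)

  ∈-∖N⁻ : ∀ {A v x} → x ∈ A ∖N[ v ] → x ∈ A ∖ v × ¬ v ~ x
  ∈-∖N⁻ {A} {v} = ∈-subset⁻ (λ x → x ∈? A ∖ v ×-dec ¬? (v ~? x))

  ∖⊂ : ∀ {A v} → v ∈ A → A ∖ v ⊂ A
  ∖⊂ v∈A = proj₁ ∘ ∈-∖⁻ , _ , v∈A , λ v∈ → proj₂ (∈-∖⁻ v∈) refl

  ∖N⊂ : ∀ {A v} → v ∈ A → A ∖N[ v ] ⊂ A
  ∖N⊂ v∈A = ⊆-⊂-trans (proj₁ ∘ ∈-∖N⁻) (∖⊂ v∈A)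

  independent-simplex : ∀ {A} → Independent A → IsSimplex (Ind A)
  independent-simplex A-ind =
    inj₂ (_ , λ τ → proj₁ , λ τ⊆A → τ⊆A , λ e∈ f∈ → A-ind (τ⊆A e∈) (τ⊆A f∈))

  ⁅⁆-face : ∀ {A v} → v ∈ A → Ind A ⁅ v ⁆
  ⁅⁆-face {A} {v} v∈A = (λ x∈ → subst (_∈ A) (sym (x∈⁅y⁆⇒x≡y v x∈)) v∈A) , independent
    where
    independent : Independent ⁅ v ⁆
    independent e∈ f∈ with refl ← x∈⁅y⁆⇒x≡y v e∈ | refl ← x∈⁅y⁆⇒x≡y v f∈ = ~-irrefl

  ∪⁅⁆-⊆ : ∀ {σ A : Subset m} {e} → σ ⊆ A → e ∈ A → σ ∪ ⁅ e ⁆ ⊆ A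
  ∪⁅⁆-⊆ {σ} {A} {e} σ⊆A e∈A x∈ =
    [ σ⊆A , (λ x∈⁅e⁆ → subst (_∈ A) (sym (x∈⁅y⁆⇒x≡y e x∈⁅e⁆)) e∈A) ] (x∈p∪q⁻ σ _ x∈)

  ∪⁅⁆-independent : ∀ {σ e} → Independent σ → (∀ {g} → g ∈ σ → ¬ e ~ g) → Independent (σ ∪ ⁅ e ⁆)
  ∪⁅⁆-independent {σ} {e} σ-ind e-free a∈ b∈ with x∈p∪q⁻ σ _ a∈ | x∈p∪q⁻ σ _ b∈
  ... | inj₁ a∈σ | inj₁ b∈σ = σ-ind a∈σ b∈σ
  ... | inj₁ a∈σ | inj₂ b∈⁅e⁆ with refl ← x∈⁅y⁆⇒x≡y e b∈⁅e⁆ = e-free a∈σ ∘ ~-sym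
  ... | inj₂ a∈⁅e⁆ | inj₁ b∈σ with refl ← x∈⁅y⁆⇒x≡y e a∈⁅e⁆ = e-free b∈σ
  ... | inj₂ a∈⁅e⁆ | inj₂ b∈⁅e⁆ with refl ← x∈⁅y⁆⇒x≡y e a∈⁅e⁆ | refl ← x∈⁅y⁆⇒x≡y e b∈⁅e⁆ = ~-irrefl

  del-Ind : ∀ {A v} → del (Ind A) v ≐ Ind (A ∖ v)
  del-Ind {A} {v} = to , from
    where
    to : ∀ {τ} → del (Ind A) v τ → Ind (A ∖ v) τ
    to (v∉τ , τ⊆A , τ-ind) = (λ x∈ → ∈-∖⁺ (τ⊆A x∈) λ { refl → v∉τ x∈ }) , τ-ind
    from : ∀ {τ} → Ind (A ∖ v) τ → del (Ind A) v τ
    from (τ⊆ , τ-ind) = (λ v∈ → proj₂ (∈-∖⁻ (τ⊆ v∈)) refl) , proj₁ ∘ ∈-∖⁻ ∘ τ⊆ , τ-ind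

  lk-Ind : ∀ {A v} → v ∈ A → lk (Ind A) v ≐ Ind (A ∖N[ v ])
  lk-Ind {A} {v} v∈A = to , from
    where
    v∈τ∪⁅v⁆ : ∀ {τ} → v ∈ τ ∪ ⁅ v ⁆
    v∈τ∪⁅v⁆ = x∈p∪q⁺ (inj₂ (x∈⁅x⁆ v))
    to : ∀ {τ} → lk (Ind A) v τ → Ind (A ∖N[ v ]) τ
    to (v∉τ , τv⊆A , τv-ind) =
      (λ x∈ → ∈-∖N⁺ (∈-∖⁺ (τv⊆A (p⊆p∪q _ x∈)) λ { refl → v∉τ x∈ }) (τv-ind v∈τ∪⁅v⁆ (p⊆p∪q _ x∈)))
      , λ e∈ f∈ → τv-ind (p⊆p∪q _ e∈) (p⊆p∪q _ f∈)
    from : ∀ {τ} → Ind (A ∖N[ v ]) τ → lk (Ind A) v τ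
    from (τ⊆ , τ-ind) =
      (λ v∈ → proj₂ (∈-∖⁻ (proj₁ (∈-∖N⁻ (τ⊆ v∈)))) refl)
      , ∪⁅⁆-⊆ (proj₁ ∘ ∈-∖⁻ ∘ proj₁ ∘ ∈-∖N⁻ ∘ τ⊆) v∈A
      , ∪⁅⁆-independent τ-ind (λ g∈ → proj₂ (∈-∖N⁻ (τ⊆ g∈)))

  facet-meets-N[_] : ∀ {A f σ} e → e ∈ A → e ≢ f → IsFacet (del (Ind A) f) σ →
                     ∃ λ g → g ∈ σ × (g ≡ e ⊎ e ~ g)
  facet-meets-N[_] {A} {f} {σ} e e∈A e≢f ((f∉σ , σ⊆A , σ-ind) , maximal) with e ∈? σ
  ... | yes e∈σ = e , e∈σ , inj₁ refl
  ... | no e∉σ with any? (λ g → g ∈? σ ×-dec e ~? g)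
  ...   | yes (g , g∈σ , e~g) = g , g∈σ , inj₂ e~g
  ...   | no e-free =
    contradiction (maximal (σ ∪ ⁅ e ⁆) σe-face (p⊆p∪q _) (x∈p∪q⁺ (inj₂ (x∈⁅x⁆ e)))) e∉σ
    where
    σe-face : del (Ind A) f (σ ∪ ⁅ e ⁆)
    σe-face = [ f∉σ , (λ f∈⁅e⁆ → e≢f (sym (x∈⁅y⁆⇒x≡y e f∈⁅e⁆))) ] ∘ x∈p∪q⁻ σ _
            , ∪⁅⁆-⊆ σ⊆A e∈A
            , ∪⁅⁆-independent σ-ind (λ g∈σ e~g → e-free (_ , g∈σ , e~g))

  dominating-shedding : ∀ {A e f} → e ∈ A → e ≢ f → Dominates A f e →
                        ∀ σ → IsFacet (del (Ind A) f) σ → IsFacet (Ind A) σ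
  dominating-shedding {A} {e} {f} e∈A e≢f f≽e σ σ-facet@((f∉σ , σ⊆A , σ-ind) , maximal) =
    (σ⊆A , σ-ind) , maximal′
    where
    maximal′ : ∀ τ → Ind A τ → σ ⊆ τ → τ ⊆ σ
    maximal′ τ (τ⊆A , τ-ind) σ⊆τ with f ∈? τ
    ... | no f∉τ = maximal τ (f∉τ , τ⊆A , τ-ind) σ⊆τ
    ... | yes f∈τ with facet-meets-N[ e ] e∈A e≢f σ-facet
    ...   | g , g∈σ , g∈N[e] with f≽e (σ⊆A g∈σ) g∈N[e]
    ...     | inj₁ refl = contradiction g∈σ f∉σ
    ...     | inj₂ f~g = contradiction f~g (τ-ind f∈τ (σ⊆τ g∈σ))

  Ind-vertexDecomposable : ∀ A → (∀ {B} → B ⊆ A → HasEdge B → DominatedPair B) →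
                           VertexDecomposable (Ind A)
  Ind-vertexDecomposable A = go (⊂-wellFounded A)
    where
    go : ∀ {A} → Acc _⊂_ A → (∀ {B} → B ⊆ A → HasEdge B → DominatedPair B) →
         VertexDecomposable (Ind A)
    go {A} (acc smaller) dominated with hasEdge? A
    ... | no edgeless = simplex (independent-simplex λ e∈ f∈ e~f → edgeless (_ , _ , e∈ , f∈ , e~f))
    ... | yes edge with dominated ⊆-refl edge
    ...   | e , f , e∈A , f∈A , e≢f , f≽e =
      shed f (⁅⁆-face f∈A)
        (vertexDecomposable-resp-≐ (≐-sym (lk-Ind f∈A)) (recurse (∖N⊂ f∈A)))
        (vertexDecomposable-resp-≐ (≐-sym del-Ind) (recurse (∖⊂ f∈A)))
        (dominating-shedding e∈A e≢f f≽e)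
      where
      recurse : ∀ {B} → B ⊂ A → VertexDecomposable (Ind B)
      recurse B⊂A = go (smaller B⊂A) (λ C⊆B → dominated (⊆-trans C⊆B (proj₁ B⊂A)))

_◂_ : ∀ {A : Set} → A → (ℕ → A) → ℕ → A
(x ◂ f) zero = x
(x ◂ f) (suc i) = f i

◂-injective : ∀ {A : Set} {n x} {f : ℕ → A} →
              (∀ {i j} → i < n → j < n → f i ≡ f j → i ≡ j) → (∀ {j} → j < n → f j ≢ x) →
              ∀ {i j} → i < suc n → j < suc n → (x ◂ f) i ≡ (x ◂ f) j → i ≡ j
◂-injective _     _     {zero}  {zero}  _         _         _     = refl
◂-injective _     fresh {zero}  {suc j} _         (s<s j<n) x≡fj  = contradiction (sym x≡fj) (fresh j<n)
◂-injective _     fresh {suc i} {zero}  (s<s i<n) _         fi≡x  = contradiction fi≡x (fresh i<n)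
◂-injective f-inj _     {suc i} {suc j} (s<s i<n) (s<s j<n) fi≡fj = cong suc (f-inj i<n j<n fi≡fj)

module _ (D : Multidigraph) where

  private
    V = Fin (nV D)
    E = Fin (nE D)

  Antiparallel : E → E → Set
  Antiparallel e f = s D e ≡ t D f × t D e ≡ s D f

  Conflict : E → E → Set
  Conflict e f = e ≢ f × (t D e ≡ t D f ⊎ Antiparallel e f)

  conflict? : ∀ e f → Dec (Conflict e f)
  conflict? e f = ¬? (e ≟ f) ×-dec (t D e ≟ t D f ⊎-dec (s D e ≟ t D f ×-dec t D e ≟ s D f))

  conflict-sym : ∀ {e f} → Conflict e f → Conflict f e
  conflict-sym (e≢f , inj₁ same) = e≢f ∘ sym , inj₁ (sym same)
  conflict-sym (e≢f , inj₂ (p , q)) = e≢f ∘ sym , inj₂ (sym q , sym p)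

  conflict-irrefl : ∀ {e} → ¬ Conflict e e
  conflict-irrefl (e≢e , _) = e≢e refl

  open IndependenceComplex conflict? conflict-sym conflict-irrefl public

  IsLoop : E → Set
  IsLoop e = s D e ≡ t D e

  nonLoops : Subset (nE D)
  nonLoops = subset λ e → ¬? (s D e ≟ t D e)

  ∈-nonLoops⁺ : ∀ {e} → ¬ IsLoop e → e ∈ nonLoops
  ∈-nonLoops⁺ = ∈-subset⁺ λ e → ¬? (s D e ≟ t D e)

  ∈-nonLoops⁻ : ∀ {e} → e ∈ nonLoops → ¬ IsLoop e
  ∈-nonLoops⁻ = ∈-subset⁻ λ e → ¬? (s D e ≟ t D e)

  forget-inP : ∀ {P k} → CycleIn D P k → CycleIn D (λ _ → ⊤) k
  forget-inP cycle = record { CycleIn cycle hiding (inP) ; inP = λ _ _ → tt }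

  loop-cycle : ∀ {P e} → P e → IsLoop e → CycleIn D P 1
  loop-cycle {e = e} Pe loop = record
    { c = λ _ → s D e ; e = λ _ → e ; closed = refl ; inP = λ _ _ → Pe
    ; src = λ _ _ → refl ; tgt = λ _ _ → sym loop ; distinct = distinct }
    where
    distinct : ∀ i j → i < 1 → j < 1 → s D e ≡ s D e → i ≡ j
    distinct _ _ z<s z<s _ = refl

  antiparallel-cycle : ∀ {P e f} → P e → P f → Antiparallel e f → ¬ IsLoop e → CycleIn D P 2
  antiparallel-cycle {P} {e} {f} Pe Pf (p , q) nonLoop = record
    { c = c ; e = e ◂ λ _ → f ; closed = refl
    ; inP = λ { zero _ → Pe ; (suc _) _ → Pf }
    ; src = λ { _ z<s → refl ; _ sz<ss → sym q }
    ; tgt = λ { _ z<s → refl ; _ sz<ss → sym p }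
    ; distinct = distinct }
    where
    c : ℕ → V
    c = s D e ◂ (t D e ◂ λ _ → s D e)
    distinct : ∀ i j → i < 2 → j < 2 → c i ≡ c j → i ≡ j
    distinct _ _ z<s   z<s   _ = refl
    distinct _ _ z<s   sz<ss r = contradiction r nonLoop
    distinct _ _ sz<ss z<s   r = contradiction (sym r) nonLoop
    distinct _ _ sz<ss sz<ss _ = refl

  cycle₁-loop : ∀ {P} → CycleIn D P 1 → ∃ λ e → P e × IsLoop e
  cycle₁-loop cycle = e 0 , inP 0 z<s , trans (src 0 z<s) (trans (sym closed) (sym (tgt 0 z<s)))
    where open CycleIn cycle

  cycle₂-conflict : ∀ {P} → CycleIn D P 2 → ∃₂ λ e f → P e × P f × Conflict e f
  cycle₂-conflict cycle = e 0 , e 1 , inP 0 z<s , inP 1 sz<ss , distinct-arcs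
                        , inj₂ (trans (src 0 z<s) (trans (sym closed) (sym (tgt 1 sz<ss)))
                               , trans (tgt 0 z<s) (sym (src 1 sz<ss)))
    where
    open CycleIn cycle
    distinct-arcs : e 0 ≢ e 1
    distinct-arcs e₀≡e₁ with () ← distinct 0 1 z<s sz<ss
      (trans (sym (src 0 z<s)) (trans (cong (s D) e₀≡e₁) (src 1 sz<ss)))

  DT⊆Ind : ∀ {τ} → DT D τ → Ind nonLoops τ
  DT⊆Ind {τ} (sameTarget⇒equal , acyclic) = τ⊆nonLoops , independent
    where
    τ⊆nonLoops : τ ⊆ nonLoops
    τ⊆nonLoops e∈τ = ∈-nonLoops⁺ (acyclic 1 z<s ∘ loop-cycle e∈τ)
    independent : Independent τ
    independent e∈τ f∈τ (e≢f , inj₁ same) = e≢f (sameTarget⇒equal _ _ e∈τ f∈τ same)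
    independent e∈τ f∈τ (_ , inj₂ anti) =
      acyclic 2 z<s (antiparallel-cycle e∈τ f∈τ anti (∈-nonLoops⁻ (τ⊆nonLoops e∈τ)))

  Ind⊆DT : TwoAcyclic D → ∀ {τ} → Ind nonLoops τ → DT D τ
  Ind⊆DT twoAcyclic {τ} (τ⊆nonLoops , independent) = sameTarget⇒equal , acyclic
    where
    sameTarget⇒equal : ∀ e f → e ∈ τ → f ∈ τ → t D e ≡ t D f → e ≡ f
    sameTarget⇒equal e f e∈τ f∈τ same =
      decidable-stable (e ≟ f) (λ e≢f → independent e∈τ f∈τ (e≢f , inj₁ same))
    acyclic : ∀ k → 1 ≤ k → ¬ CycleIn D (_∈ τ) k
    acyclic 1 _ cycle with e , e∈τ , loop ← cycle₁-loop cycle = ∈-nonLoops⁻ (τ⊆nonLoops e∈τ) loop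
    acyclic 2 _ cycle with e , f , e∈τ , f∈τ , conflict ← cycle₂-conflict cycle =
      independent e∈τ f∈τ conflict
    acyclic (suc (suc (suc k))) _ = twoAcyclic _ (s≤s (s≤s z<s)) ∘ forget-inP

  DT≐Ind : TwoAcyclic D → DT D ≐ Ind nonLoops
  DT≐Ind twoAcyclic = DT⊆Ind , Ind⊆DT twoAcyclic

  record SimplePath (n : ℕ) : Set where
    field
      vertex           : ℕ → V
      arc              : ℕ → E
      arc-src          : ∀ {i} → suc i < n → s D (arc i) ≡ vertex i
      arc-tgt          : ∀ {i} → suc i < n → t D (arc i) ≡ vertex (suc i)
      vertex-injective : ∀ {i j} → i < n → j < n → vertex i ≡ vertex j → i ≡ j

  open SimplePath

  simplePath-length : ∀ {n} → SimplePath n → n ≤ nV D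
  simplePath-length P =
    injective⇒≤ λ {i} {j} eq → toℕ-injective (vertex-injective P (toℕ<n i) (toℕ<n j) eq)

  arc-path : ∀ a → ¬ IsLoop a → SimplePath 2
  arc-path a nonLoop = record
    { vertex = s D a ◂ λ _ → t D a ; arc = λ _ → a
    ; arc-src = λ { sz<ss → refl } ; arc-tgt = λ { sz<ss → refl }
    ; vertex-injective = ◂-injective (λ { z<s z<s _ → refl }) (λ { z<s → nonLoop ∘ sym }) }

  prepend : ∀ {n} (P : SimplePath n) a → t D a ≡ vertex P 0 →
            (∀ {j} → j < n → vertex P j ≢ s D a) → SimplePath (suc n)
  prepend P a a-tgt fresh = record
    { vertex = s D a ◂ vertex P ; arc = a ◂ arc P
    ; arc-src = λ { {zero} _ → refl ; {suc i} (s<s i<n) → arc-src P i<n }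
    ; arc-tgt = λ { {zero} _ → a-tgt ; {suc i} (s<s i<n) → arc-tgt P i<n }
    ; vertex-injective = ◂-injective (vertex-injective P) fresh }

  closing-cycle : ∀ {n} (P : SimplePath n) a → t D a ≡ vertex P 0 →
                  ∀ {i} → i < n → vertex P i ≡ s D a → CycleIn D (λ _ → ⊤) (suc i)
  closing-cycle P a a-tgt {i} i<n closes = record
    { c = s D a ◂ vertex P ; e = a ◂ arc P ; closed = closes ; inP = λ _ _ → tt
    ; src = λ { zero _ → refl ; (suc j) (s<s j<i) → arc-src P (≤-trans (s≤s j<i) i<n) }
    ; tgt = λ { zero _ → a-tgt ; (suc j) (s<s j<i) → arc-tgt P (≤-trans (s≤s j<i) i<n) }
    ; distinct = λ _ _ → ◂-injective
        (λ j<i j′<i → vertex-injective P (<-trans j<i i<n) (<-trans j′<i i<n))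
        (λ j<i vⱼ≡sa → <⇒≢ j<i
           (vertex-injective P (<-trans j<i i<n) i<n (trans vⱼ≡sa (sym closes)))) }

  Arc : Subset (nE D) → V → V → Set
  Arc B x y = ∃ λ a → a ∈ B × s D a ≡ x × t D a ≡ y

  arc? : ∀ B x y → Dec (Arc B x y)
  arc? B x y = any? λ a → a ∈? B ×-dec s D a ≟ x ×-dec t D a ≟ y

  Digon : Subset (nE D) → V → V → Set
  Digon B x y = Arc B x y × Arc B y x

  digon? : ∀ B x y → Dec (Digon B x y)
  digon? B x y = arc? B x y ×-dec arc? B y x

  DigonLeaf : Subset (nE D) → Set
  DigonLeaf B = ∃₂ λ u w → Digon B u w × (∀ {x} → Digon B w x → x ≡ u)

  module _ (twoAcyclic : TwoAcyclic D) {B : Subset (nE D)} (B⊆nonLoops : B ⊆ nonLoops) where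

    -- Returning to a vertex of the path would close a
    -- directed cycle of length ≥ 3, so within nV D steps the search stops at a leaf of the
    -- digon graph.
    digonLeaf-search : ∀ fuel {n} (P : SimplePath (suc (suc n))) →
                       Digon B (vertex P 1) (vertex P 0) → nV D ≤ fuel + suc n → DigonLeaf B
    digonLeaf-search zero P _ bound = contradiction (simplePath-length P) (≤⇒≯ bound)
    digonLeaf-search (suc fuel) {n} P end bound
      with any? (λ x → ¬? (x ≟ vertex P 1) ×-dec digon? B (vertex P 0) x)
    ... | no noOther = vertex P 1 , vertex P 0 , end , λ {x} digon →
            decidable-stable (x ≟ vertex P 1) (λ x≢v₁ → noOther (x , x≢v₁ , digon))
    ... | yes (_ , sa≢v₁ , next@(_ , a , a∈B , refl , a-tgt))
      with anyUpTo? (λ j → vertex P j ≟ s D a) (suc (suc n))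
    ...   | no fresh =
      digonLeaf-search fuel (prepend P a a-tgt (λ j< vⱼ≡sa → fresh (_ , j< , vⱼ≡sa))) next
        (subst (nV D ≤_) (sym (+-suc fuel (suc n))) bound)
    ...   | yes (zero , _ , v₀≡sa) =
      contradiction (trans (sym v₀≡sa) (sym a-tgt)) (∈-nonLoops⁻ (B⊆nonLoops a∈B))
    ...   | yes (suc zero , _ , v₁≡sa) = contradiction (sym v₁≡sa) sa≢v₁
    ...   | yes (suc (suc j) , j< , vⱼ≡sa) =
      ⊥-elim (twoAcyclic _ (s≤s (s≤s z<s)) (closing-cycle P a a-tgt j< vⱼ≡sa))

    digonLeaf : ∀ {u w} → Digon B u w → DigonLeaf B
    digonLeaf digon@(_ , b , b∈B , refl , refl) =
      digonLeaf-search (nV D) (arc-path b (∈-nonLoops⁻ (B⊆nonLoops b∈B))) digon (m≤m+n _ _)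

    SharedTargetsReversible : Set
    SharedTargetsReversible =
      ∀ {e f} → e ∈ B → f ∈ B → e ≢ f → t D e ≡ t D f → Arc B (t D e) (s D e)

    sharedTarget-dominates : ∀ {e f} → f ≢ e → t D e ≡ t D f → ¬ Arc B (t D e) (s D e) →
                             Dominates B f e
    sharedTarget-dominates f≢e same _ _ (inj₁ refl) = inj₂ (f≢e , inj₁ (sym same))
    sharedTarget-dominates {f = f} _ same _ {g} _ (inj₂ (_ , inj₁ same′)) with g ≟ f
    ... | yes g≡f = inj₁ g≡f
    ... | no g≢f = inj₂ (g≢f ∘ sym , inj₁ (trans (sym same) same′))
    sharedTarget-dominates _ _ irreversible g∈B (inj₂ (_ , inj₂ (p , q))) =
      ⊥-elim (irreversible (_ , g∈B , sym q , sym p))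

    -- For a leaf w with unique digon neighbour u, the arc e : u → w is dominated by its reverse
    -- f : w → u: every other edge into w is reversible, hence lies in a digon at w, hence comes
    -- from u.
    leaf-dominates : SharedTargetsReversible → ∀ {e f} → e ∈ B → f ≢ e → Antiparallel e f →
                     (∀ {x} → Digon B (t D e) x → x ≡ s D e) → Dominates B f e
    leaf-dominates _ _ f≢e (p , q) _ _ (inj₁ refl) = inj₂ (f≢e , inj₂ (sym q , sym p))
    leaf-dominates reversible {e} {f} e∈B _ (p , q) leaf {g} g∈B (inj₂ (e≢g , inj₁ same)) with g ≟ f
    ... | yes g≡f = inj₁ g≡f
    ... | no g≢f = inj₂ (g≢f ∘ sym , inj₂ (trans (sym q) same , trans (sym p) (sym (leaf g-digon))))
      where
      g-digon : Digon B (t D e) (s D g)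
      g-digon = subst (λ w → Arc B w (s D g)) (sym same) (reversible g∈B e∈B (e≢g ∘ sym) (sym same))
              , (g , g∈B , refl , sym same)
    leaf-dominates _ {f = f} _ _ (p , _) _ {g} _ (inj₂ (_ , inj₂ (p′ , _))) with g ≟ f
    ... | yes g≡f = inj₁ g≡f
    ... | no g≢f = inj₂ (g≢f ∘ sym , inj₁ (trans (sym p) p′))

    conflict-digon : SharedTargetsReversible → ∀ {e f} → e ∈ B → f ∈ B → Conflict e f →
                     Digon B (s D e) (t D e)
    conflict-digon reversible e∈B f∈B (e≢f , inj₁ same) =
      (_ , e∈B , refl , refl) , reversible e∈B f∈B e≢f same
    conflict-digon _ e∈B f∈B (_ , inj₂ (p , q)) =
      (_ , e∈B , refl , refl) , (_ , f∈B , sym q , sym p)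

    sharedTargets-dichotomy :
      (∃₂ λ e f → e ∈ B × f ∈ B × e ≢ f × t D e ≡ t D f × ¬ Arc B (t D e) (s D e))
      ⊎ SharedTargetsReversible
    sharedTargets-dichotomy
      with any? (λ e → any? (λ f → e ∈? B ×-dec f ∈? B ×-dec ¬? (e ≟ f) ×-dec t D e ≟ t D f
                                     ×-dec ¬? (arc? B (t D e) (s D e))))
    ... | yes (e , f , irreversiblePair) = inj₁ (e , f , irreversiblePair)
    ... | no none = inj₂ λ e∈B f∈B e≢f same →
      decidable-stable (arc? B _ _) λ irreversible →
        none (_ , _ , e∈B , f∈B , e≢f , same , irreversible)

    leaf-dominatedPair : SharedTargetsReversible → HasEdge B → DominatedPair B
    leaf-dominatedPair reversible (_ , _ , g∈B , h∈B , g~h)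
      with digonLeaf (conflict-digon reversible g∈B h∈B g~h)
    ... | _ , _ , ((e , e∈B , refl , refl) , (f , f∈B , f-src , f-tgt)) , leaf =
      e , f , e∈B , f∈B , e≢f
      , leaf-dominates reversible e∈B (e≢f ∘ sym) (sym f-tgt , sym f-src) leaf
      where
      e≢f : e ≢ f
      e≢f refl = ∈-nonLoops⁻ (B⊆nonLoops e∈B) f-src

    dominatedPair : HasEdge B → DominatedPair B
    dominatedPair edge with sharedTargets-dichotomy
    ... | inj₁ (e , f , e∈B , f∈B , e≢f , same , irreversible) =
      e , f , e∈B , f∈B , e≢f , sharedTarget-dominates (e≢f ∘ sym) same irreversible
    ... | inj₂ reversible = leaf-dominatedPair reversible edge

corollary4p4 : (D : Multidigraph) → TwoAcyclic D → VertexDecomposable (DT D)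
corollary4p4 D twoAcyclic =
  vertexDecomposable-resp-≐ (≐-sym (DT≐Ind D twoAcyclic))
    (Ind-vertexDecomposable D (nonLoops D) (dominatedPair D twoAcyclic))
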